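{- Suppose that $\mathbf{w}\in\{0,1,2\}^\omega$ contains no factor of exponent $\ge 5/2$. Let $a,b,c\in\{0,1,2\}^+$ and let $g$ be the morphism $g(0)=a$, $g(1)=b$, $g(2)=c$. Suppose a final segment (suffix) of $\mathbf{w}$ equals $g(\mathbf{u})$ for some $\mathbf{u}\in\{0,1,2\}^\omega$, and that: (1) $b$ is a prefix of $a$, and $a$ is a prefix of $c$; (2) $|b|\ge |c|/2$; (3) $b$ and $c$ have a common suffix $s$ with $|s|\ge |b|/2$. Then, in the factorization of $g(\mathbf{u})$ into blocks $a,b,c$ given by the letters of $\mathbf{u}$, no two consecutive blocks are $aa$, $bb$, $cb$ or $cc$; that is, $\mathbf{u}$ contains none of the factors $00$, $11$, $21$, $22$.
   Context: The exponent of a finite nonempty word $x$ with smallest period $p$ is $|x|/p$. A final segment of an infinite word is a suffix obtained by deleting a finite prefix. -}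

module Defs where

open import Data.Nat using (ℕ; zero; suc; _+_; _*_; _≤_; _<_)
open import Data.Fin using (Fin; toℕ)
open import Data.List using (List; length; lookup; _++_)
open import Data.Product using (∃; _×_)
open import Relation.Binary.PropositionalEquality using (_≡_)

Word∞ : Set
Word∞ = ℕ → Fin 3

IsPeriod : Word∞ → ℕ → ℕ → ℕ → Set
IsPeriod w i n p = (1 ≤ p) × (p ≤ n) ×
  (∀ j → j + p < n → w (i + j) ≡ w (i + j + p))

IsSmallestPeriod : Word∞ → ℕ → ℕ → ℕ → Set
IsSmallestPeriod w i n p = IsPeriod w i n p × (∀ q → IsPeriod w i n q → p ≤ q)

-- w has a (nonempty) factor of exponent ≥ 5/2: n / p ≥ 5/2, i.e. 5p ≤ 2n.
HasFactorExp≥5/2 : Word∞ → Set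
HasFactorExp≥5/2 w = ∃ λ i → ∃ λ n → ∃ λ p →
  (1 ≤ n) × IsSmallestPeriod w i n p × (5 * p ≤ 2 * n)

morph : List (Fin 3) → List (Fin 3) → List (Fin 3) → Fin 3 → List (Fin 3)
morph a b c Fin.zero = a
morph a b c (Fin.suc Fin.zero) = b
morph a b c (Fin.suc (Fin.suc Fin.zero)) = c

blockPos : (Fin 3 → List (Fin 3)) → Word∞ → ℕ → ℕ
blockPos g u zero = 0
blockPos g u (suc n) = blockPos g u n + length (g (u n))

-- The suffix of w starting at position m equals g(u), where g is nonerasing:
-- every block g(u n) occurs in w at position m + blockPos g u n.
SuffixIsImage : Word∞ → ℕ → (Fin 3 → List (Fin 3)) → Word∞ → Set
SuffixIsImage w m g u = ∀ n (j : Fin (length (g (u n)))) →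
  w (m + blockPos g u n + toℕ j) ≡ lookup (g (u n)) j

_IsPrefixOf_ : List (Fin 3) → List (Fin 3) → Set
x IsPrefixOf y = ∃ λ t → x ++ t ≡ y

_IsSuffixOf_ : List (Fin 3) → List (Fin 3) → Set
x IsSuffixOf y = ∃ λ t → t ++ x ≡ y

{-# OPTIONS --safe #-}
module Submission where

-- Every forbidden pair of blocks, followed by the prefix b of the next block,
-- yields a factor x x y of w with y a prefix of x and |x| ≤ 2|y|; such a factor
-- has period |x| and length 2|x| + |y| ≥ 5|x|/2.  For aa, bb and cc this is
-- the factor aab, bbb or ccb.  For cb, write c = t s and b = t′ s: then
-- c b b = t (s t′)(s t′) s, and |s t′| = |b| ≤ 2|s|.

open import Defs
open import Data.Nat using (ℕ; _+_; _*_; _≤_; _<_; s≤s)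
import Data.Nat as N
open import Data.Nat.Properties
open import Data.Nat.Induction using (<-rec)
open import Data.Nat.Tactic.RingSolver using (solve)
open import Data.Fin using (Fin; zero; suc; toℕ)
open import Data.List using (List; []; _∷_; _++_; length; lookup)
open import Data.List.Properties
  using (length-++; length-++-comm; ++-assoc; ++-identityʳ; ∷-injectiveˡ; ∷-injectiveʳ)
open import Data.Product using (∃; _×_; _,_; proj₁; proj₂)
open import Relation.Binary.PropositionalEquality
  using (_≡_; refl; sym; trans; cong; cong₂; subst; module ≡-Reasoning)
open import Relation.Nullary using (¬_)

factor : Word∞ → ℕ → ℕ → List (Fin 3)
factor w i N.zero    = []
factor w i (N.suc n) = w i ∷ factor w (N.suc i) n

OccursAt : Word∞ → ℕ → List (Fin 3) → Set
OccursAt w i x = factor w i (length x) ≡ x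

occursAt-cong : ∀ {w i j x} → i ≡ j → OccursAt w i x → OccursAt w j x
occursAt-cong refl occ = occ

lookup⇒occursAt : ∀ {w i} x → (∀ (j : Fin (length x)) → w (i + toℕ j) ≡ lookup x j) → OccursAt w i x
lookup⇒occursAt         []      _ = refl
lookup⇒occursAt {w} {i} (y ∷ x) h = cong₂ _∷_
  (trans (cong w (sym (+-identityʳ i))) (h zero))
  (lookup⇒occursAt x λ j → trans (cong w (sym (+-suc i (toℕ j)))) (h (suc j)))

occursAt-++⁻ : ∀ {w i} x {y} → OccursAt w i (x ++ y) → OccursAt w i x × OccursAt w (i + length x) y
occursAt-++⁻ {i = i} []      occ = refl , occursAt-cong (sym (+-identityʳ i)) occ
occursAt-++⁻ {i = i} (z ∷ x) occ =
  let occ-x , occ-y = occursAt-++⁻ x (∷-injectiveʳ occ)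
  in cong₂ _∷_ (∷-injectiveˡ occ) occ-x , occursAt-cong (sym (+-suc i (length x))) occ-y

occursAt-++⁺ : ∀ {w i} x {y} → OccursAt w i x → OccursAt w (i + length x) y → OccursAt w i (x ++ y)
occursAt-++⁺ {i = i} []      _     occ-y = occursAt-cong (+-identityʳ i) occ-y
occursAt-++⁺ {i = i} (z ∷ x) occ-x occ-y = cong₂ _∷_ (∷-injectiveˡ occ-x)
  (occursAt-++⁺ x (∷-injectiveʳ occ-x) (occursAt-cong (+-suc i (length x)) occ-y))

occursAt-prefix : ∀ {w i x y} → y IsPrefixOf x → OccursAt w i x → OccursAt w i y
occursAt-prefix {y = y} (_ , refl) occ = proj₁ (occursAt-++⁻ y occ)

factor-agree : ∀ {w} n {i j} → factor w i n ≡ factor w j n → ∀ k → k < n → w (i + k) ≡ w (j + k)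
factor-agree (N.suc n) {i} {j} eq N.zero    _         rewrite +-identityʳ i | +-identityʳ j = ∷-injectiveˡ eq
factor-agree (N.suc n) {i} {j} eq (N.suc k) (s≤s k<n) rewrite +-suc i k | +-suc j k =
  factor-agree n (∷-injectiveʳ eq) k k<n

factor-shift⇒period : ∀ {w i n p} → 1 ≤ p → factor w i n ≡ factor w (i + p) n → IsPeriod w i (p + n) p
factor-shift⇒period {w} {i} {n} {p} 1≤p eq = 1≤p , m≤m+n p n , λ k k+p<p+n → begin
  w (i + k)     ≡⟨ factor-agree n eq k (+-cancelʳ-< p k n (subst (k + p <_) (+-comm p n) k+p<p+n)) ⟩
  w (i + p + k) ≡⟨ cong w (solve (i ∷ p ∷ k ∷ [])) ⟩
  w (i + k + p) ∎
  where open ≡-Reasoning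

m≤2n⇒5m≤2[m+m+n] : ∀ {m n} → m ≤ 2 * n → 5 * m ≤ 2 * (m + (m + n))
m≤2n⇒5m≤2[m+m+n] {m} {n} m≤2n = begin
  5 * m             ≡⟨ solve (m ∷ []) ⟩
  4 * m + m         ≤⟨ +-monoʳ-≤ (4 * m) m≤2n ⟩
  4 * m + 2 * n     ≡⟨ solve (m ∷ n ∷ []) ⟩
  2 * (m + (m + n)) ∎
  where open ≤-Reasoning

module _ {w : Word∞} (w-free : ¬ HasFactorExp≥5/2 w) where

  -- By well-founded induction every smaller period is excluded, so p itself is
  -- the smallest period; no decision procedure for periods is needed.
  ¬short-period : ∀ {i n} p → 5 * p ≤ 2 * n → ¬ IsPeriod w i n p
  ¬short-period {i} {n} = <-rec _ λ p ¬shorter 5p≤2n per@(1≤p , p≤n , _) →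
    w-free (i , n , p , ≤-trans 1≤p p≤n , (per , λ q per-q → ≮⇒≥ λ q<p →
      ¬shorter q<p (≤-trans (*-monoʳ-≤ 5 (<⇒≤ q<p)) 5p≤2n) per-q) , 5p≤2n)

  ¬power : ∀ {i x y} → y IsPrefixOf x → 1 ≤ length x → length x ≤ 2 * length y →
           ¬ OccursAt w i (x ++ x ++ y)
  ¬power {i} {x} {y} y⊑x 1≤|x| |x|≤2|y| occ =
    ¬short-period (length x) exponent (factor-shift⇒period 1≤|x| (trans xy-at-i (sym xy-at-i+|x|)))
    where
    xy-at-i+|x| : OccursAt w (i + length x) (x ++ y)
    xy-at-i+|x| = proj₂ (occursAt-++⁻ x occ)
    xy-at-i : OccursAt w i (x ++ y)
    xy-at-i = occursAt-++⁺ x (proj₁ (occursAt-++⁻ x occ))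
      (occursAt-prefix y⊑x (proj₁ (occursAt-++⁻ x xy-at-i+|x|)))
    exponent : 5 * length x ≤ 2 * (length x + length (x ++ y))
    exponent = subst (λ L → 5 * length x ≤ 2 * (length x + L)) (sym (length-++ x))
      (m≤2n⇒5m≤2[m+m+n] |x|≤2|y|)

module _ {w : Word∞} {m : ℕ} {g : Fin 3 → List (Fin 3)} {u : Word∞}
         (image : SuffixIsImage w m g u) where

  block-occurs : ∀ k → OccursAt w (m + blockPos g u k) (g (u k))
  block-occurs k = lookup⇒occursAt (g (u k)) (image k)

  block-start-suc : ∀ k → m + blockPos g u (N.suc k) ≡ m + blockPos g u k + length (g (u k))
  block-start-suc k = sym (+-assoc m _ _)

  consecutive-blocks-occur : ∀ {k x y v} → v IsPrefixOf g (u (N.suc (N.suc k))) →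
    u k ≡ x → u (N.suc k) ≡ y → OccursAt w (m + blockPos g u k) (g x ++ g y ++ v)
  consecutive-blocks-occur {k} {v = v} v⊑ refl refl =
    occursAt-++⁺ (g (u k)) (block-occurs k) (occursAt-++⁺ (g (u (N.suc k))) next-occurs v-occurs)
    where
    next-start : ℕ
    next-start = m + blockPos g u k + length (g (u k))
    next-occurs : OccursAt w next-start (g (u (N.suc k)))
    next-occurs = occursAt-cong (block-start-suc k) (block-occurs (N.suc k))
    v-occurs : OccursAt w (next-start + length (g (u (N.suc k)))) v
    v-occurs = occursAt-cong
      (trans (block-start-suc (N.suc k)) (cong (_+ length (g (u (N.suc k)))) (block-start-suc k)))
      (occursAt-prefix v⊑ (block-occurs (N.suc (N.suc k))))

⊑-trans : ∀ {x y z} → x IsPrefixOf y → y IsPrefixOf z → x IsPrefixOf z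
⊑-trans {x} (t , refl) (t′ , refl) = t ++ t′ , sym (++-assoc x t t′)

⊑-length : ∀ {x y} → x IsPrefixOf y → length x ≤ length y
⊑-length {x} (t , refl) = subst (length x ≤_) (sym (length-++ x)) (m≤m+n (length x) (length t))

common-suffix-regroup : ∀ {A : Set} (t t′ s : List A) →
  (t ++ s) ++ (t′ ++ s) ++ t′ ++ s ≡ t ++ (s ++ t′) ++ (s ++ t′) ++ s
common-suffix-regroup t t′ s = begin
  (t ++ s) ++ (t′ ++ s) ++ t′ ++ s      ≡⟨ ++-assoc t s _ ⟩
  t ++ s ++ (t′ ++ s) ++ t′ ++ s        ≡⟨ cong (λ z → t ++ s ++ z) (++-assoc t′ s _) ⟩
  t ++ s ++ t′ ++ s ++ t′ ++ s          ≡⟨ cong (t ++_) (++-assoc s t′ _) ⟨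
  t ++ (s ++ t′) ++ s ++ t′ ++ s        ≡⟨ cong (λ z → t ++ (s ++ t′) ++ z) (++-assoc s t′ s) ⟨
  t ++ (s ++ t′) ++ (s ++ t′) ++ s      ∎
  where open ≡-Reasoning

lemma1 : (w : Word∞) → ¬ HasFactorExp≥5/2 w →
    (a b c : List (Fin 3)) → 1 ≤ length a → 1 ≤ length b → 1 ≤ length c →
    (u : Word∞) → (m : ℕ) → SuffixIsImage w m (morph a b c) u →
    b IsPrefixOf a → a IsPrefixOf c →
    length c ≤ 2 * length b →
    (∃ λ s → s IsSuffixOf b × s IsSuffixOf c × length b ≤ 2 * length s) →
    ∀ n → ¬ (u n ≡ zero × u (N.suc n) ≡ zero) × ¬ (u n ≡ suc zero × u (N.suc n) ≡ suc zero)
        × ¬ (u n ≡ suc (suc zero) × u (N.suc n) ≡ suc zero) × ¬ (u n ≡ suc (suc zero) × u (N.suc n) ≡ suc (suc zero))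
lemma1 w w-free a b c 1≤|a| 1≤|b| 1≤|c| u m image b⊑a a⊑c |c|≤2|b|
       (s , (t′ , refl) , (t , refl) , |b|≤2|s|) n =
    (λ (e₀ , e₁) → ¬power w-free b⊑a 1≤|a| (≤-trans (⊑-length a⊑c) |c|≤2|b|) (blocks e₀ e₁))
  , (λ (e₀ , e₁) → ¬power w-free ([] , ++-identityʳ b) 1≤|b| (m≤n*m (length b) 2) (blocks e₀ e₁))
  , (λ (e₀ , e₁) → ¬power w-free {y = s} (t′ , refl) 1≤|st′| |st′|≤2|s| (st′st′s-occurs e₀ e₁))
  , (λ (e₀ , e₁) → ¬power w-free (⊑-trans b⊑a a⊑c) 1≤|c| |c|≤2|b| (blocks e₀ e₁))
  where
  g = morph a b c

  b⊑g : ∀ x → b IsPrefixOf g x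
  b⊑g zero             = b⊑a
  b⊑g (suc zero)       = [] , ++-identityʳ b
  b⊑g (suc (suc zero)) = ⊑-trans b⊑a a⊑c

  blocks : ∀ {x y} → u n ≡ x → u (N.suc n) ≡ y → OccursAt w (m + blockPos g u n) (g x ++ g y ++ b)
  blocks = consecutive-blocks-occur image (b⊑g (u (N.suc (N.suc n))))

  st′st′s-occurs : u n ≡ suc (suc zero) → u (N.suc n) ≡ suc zero →
                   OccursAt w (m + blockPos g u n + length t) ((s ++ t′) ++ (s ++ t′) ++ s)
  st′st′s-occurs e₀ e₁ =
    proj₂ (occursAt-++⁻ t (subst (OccursAt w _) (common-suffix-regroup t t′ s) (blocks e₀ e₁)))

  1≤|st′| : 1 ≤ length (s ++ t′)
  1≤|st′| = subst (1 ≤_) (length-++-comm t′ s) 1≤|b|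

  |st′|≤2|s| : length (s ++ t′) ≤ 2 * length s
  |st′|≤2|s| = subst (_≤ 2 * length s) (length-++-comm t′ s) |b|≤2|s|
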